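{- Let $G=(X,Y,E)$ be a complete bipartite graph with parts $X$ and $Y$. Then there exists an ordering $\sigma$ of $X\cup Y$ such that $$I(\sigma,G)=|X|\cdot|Y|+(|X|\bmod 2)\cdot(|Y|\bmod 2).$$
   Context: All graphs are finite, simple, undirected and connected. An ordering of a finite set $V$ is a bijection $\sigma:V\to\{1,\dots,|V|\}$; $u<_\sigma v$ means $\sigma(u)<\sigma(v)$. For a graph $G=(V,E)$ and an ordering $\sigma$ of $V$, the imbalance of a vertex $v$ is $I(v,\sigma,G)=\big|\,|\{u\in N(v): u<_\sigma v\}|-|\{u\in N(v): u>_\sigma v\}|\,\big|$, where $N(v)$ is the set of neighbours of $v$, and the imbalance of the ordering is $I(\sigma,G)=\sum_{v\in V}I(v,\sigma,G)$. -}

module Defs where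

open import Data.Nat using (ℕ; zero; suc; _<ᵇ_; ∣_-_∣; _+_)
open import Data.Bool using (Bool; true; false; _∧_; not; _xor_; if_then_else_)
open import Data.Fin using (Fin; toℕ)
open import Data.List using (List; map; allFin)
open import Data.Nat.ListAction using (sum)
open import Data.Fin.Permutation using (Permutation′; _⟨$⟩ʳ_)
open import Relation.Binary.PropositionalEquality using (_≡_)

record Graph (N : ℕ) : Set where
  field
    adj     : Fin N → Fin N → Bool
    symm    : ∀ u v → adj u v ≡ adj v u
    irrefl  : ∀ v → adj v v ≡ false
open Graph public

data Reachable {N : ℕ} (G : Graph N) : Fin N → Fin N → Set where
  here  : ∀ {u} → Reachable G u u
  step  : ∀ {u w v} → adj G u w ≡ true → Reachable G w v → Reachable G u v

Connected : {N : ℕ} → Graph N → Set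
Connected {N} G = ∀ (u v : Fin N) → Reachable G u v

count : {N : ℕ} → (Fin N → Bool) → ℕ
count {N} p = sum (map (λ u → if p u then 1 else 0) (allFin N))

-- G is complete bipartite with parts X = {v | part v ≡ true}, Y = {v | part v ≡ false}
IsCompleteBipartite : {N : ℕ} → Graph N → (Fin N → Bool) → Set
IsCompleteBipartite {N} G part = ∀ (u v : Fin N) → adj G u v ≡ (part u xor part v)

-- An ordering of the vertex set: a bijection Fin N → Fin N (= {1..N} shifted to {0..N-1}).
Ordering : ℕ → Set
Ordering N = Permutation′ N

_<[_]_ : {N : ℕ} → Fin N → Ordering N → Fin N → Bool
u <[ σ ] v = toℕ (σ ⟨$⟩ʳ u) <ᵇ toℕ (σ ⟨$⟩ʳ v)

vertexImbalance : {N : ℕ} → Graph N → Ordering N → Fin N → ℕ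
vertexImbalance G σ v =
  ∣ count (λ u → adj G v u ∧ (u <[ σ ] v)) - count (λ u → adj G v u ∧ (v <[ σ ] u)) ∣

imbalance : {N : ℕ} → Graph N → Ordering N → ℕ
imbalance {N} G σ = sum (map (vertexImbalance G σ) (allFin N))

module Submission where

-- Split each part into a first half L, a second half R and, when its size is odd, one
-- middle vertex M, and order the blocks X_L < Y_L < X_M < Y_M < Y_R < X_R.  A vertex of
-- X_L or X_R has all of Y on one side, so its imbalance is |Y|; a vertex of X_M has
-- ⌊|Y|/2⌋ neighbours before it and ⌈|Y|/2⌉ after it, so its imbalance is |Y| mod 2; and
-- every vertex of Y has X_L before and X_R after it, X_M deciding the difference, so its
-- imbalance is |X| mod 2.  Summing, 2⌊|X|/2⌋|Y| + (|X| mod 2)(|Y| mod 2) + |Y|(|X| mod 2)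
-- = |X||Y| + (|X| mod 2)(|Y| mod 2).

open import Defs
open import Data.Nat using (ℕ; zero; suc; _+_; _*_; _/_; _%_; _<_; _≤_; _<ᵇ_; ∣_-_∣; z≤n; s≤s)
open import Data.Nat.Properties
open import Data.Nat.DivMod using (m≡m%n+[m/n]*n)
open import Data.Nat.Solver using (module +-*-Solver)
import Data.Nat.ListAction as List
open import Algebra.Properties.CommutativeMonoid.Sum +-0-commutativeMonoid
  using (sum-syntax; sum-cong-≗; ∑-distrib-+)
open import Data.Bool using (Bool; true; false; not; _∧_; _xor_; if_then_else_; T)
open import Data.Empty using (⊥-elim)
open import Data.Fin using (Fin; toℕ; fromℕ<; punchOut; combine)
import Data.Fin as Fin
open import Data.Fin.Patterns using (0F; 1F; 2F; 3F; 4F; 5F)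
open import Data.Fin.Properties
  using (toℕ<n; toℕ-fromℕ<; toℕ-injective; any?; punchOut-injective; <⇒notInjective;
         combine-monoˡ-<; combine-injectiveʳ)
  renaming (_≟_ to _≟ᶠ_)
open import Data.Fin.Permutation using (Permutation′; permutation; _⟨$⟩ʳ_)
open import Data.List using (map; allFin; tabulate)
open import Data.List.Properties using (map-tabulate)
open import Data.Product using (∃; _,_; proj₁; proj₂)
open import Function using (_∘_; id)
open import Function.Definitions using (Injective)
open import Relation.Binary using (tri<; tri≈; tri>)
open import Relation.Binary.PropositionalEquality
  using (_≡_; _≢_; ≢-sym; refl; sym; trans; cong; cong₂; subst; module ≡-Reasoning)
open import Relation.Nullary using (yes; no; contradiction)

indicator : Bool → ℕ
indicator b = if b then 1 else 0

<⇒<ᵇ≡true : ∀ {m n} → m < n → (m <ᵇ n) ≡ true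
<⇒<ᵇ≡true {m} {n} m<n with m <ᵇ n | <⇒<ᵇ m<n
... | true | _ = refl

<ᵇ≡true⇒< : ∀ {m n} → (m <ᵇ n) ≡ true → m < n
<ᵇ≡true⇒< {m} {n} eq = <ᵇ⇒< m n (subst T (sym eq) _)

≥⇒<ᵇ≡false : ∀ {m n} → n ≤ m → (m <ᵇ n) ≡ false
≥⇒<ᵇ≡false {m} {n} n≤m with m <ᵇ n in eq
... | false = refl
... | true  = contradiction (<ᵇ≡true⇒< eq) (≤⇒≯ n≤m)

combine-<ᵇ : ∀ {m n} {i k : Fin m} (j l : Fin n) → i ≢ k →
  (toℕ (combine i j) <ᵇ toℕ (combine k l)) ≡ (toℕ i <ᵇ toℕ k)
combine-<ᵇ {i = i} {k} j l i≢k with <-cmp (toℕ i) (toℕ k)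
... | tri< i<k _ _ = trans (<⇒<ᵇ≡true (combine-monoˡ-< j l i<k)) (sym (<⇒<ᵇ≡true i<k))
... | tri≈ _ i≡k _ = contradiction (toℕ-injective i≡k) i≢k
... | tri> _ _ k<i =
  trans (≥⇒<ᵇ≡false (<⇒≤ (combine-monoˡ-< l j k<i))) (sym (≥⇒<ᵇ≡false (<⇒≤ k<i)))

sum-tabulate : ∀ n (f : Fin n → ℕ) → List.sum (tabulate f) ≡ ∑[ i < n ] f i
sum-tabulate zero    f = refl
sum-tabulate (suc n) f = cong (f 0F +_) (sum-tabulate n (f ∘ Fin.suc))

sum-allFin : ∀ n (f : Fin n → ℕ) → List.sum (map f (allFin n)) ≡ ∑[ i < n ] f i
sum-allFin n f = trans (cong List.sum (map-tabulate id f)) (sum-tabulate n f)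

∑-const : ∀ k c → ∑[ j < k ] c ≡ c * k
∑-const zero    c = sym (*-zeroʳ c)
∑-const (suc k) c = trans (cong (c +_) (∑-const k c)) (sym (*-suc c k))

∑-range-+ : ∀ m k (φ : ℕ → ℕ) →
  ∑[ j < m + k ] φ (toℕ j) ≡ ∑[ j < m ] φ (toℕ j) + ∑[ j < k ] φ (m + toℕ j)
∑-range-+ zero    k φ = refl
∑-range-+ (suc m) k φ =
  trans (cong (φ 0 +_) (∑-range-+ m k (φ ∘ suc))) (sym (+-assoc (φ 0) _ _))

sumOver : ∀ {n} → (Fin n → Bool) → (Fin n → ℕ) → ℕ
sumOver {n} P f = ∑[ u < n ] (if P u then f u else 0)

size : ∀ {n} → (Fin n → Bool) → ℕ
size P = sumOver P (λ _ → 1)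

sumOver-cong : ∀ {n} {P Q : Fin n → Bool} {f g : Fin n → ℕ} →
  (∀ u → P u ≡ Q u) → (∀ u → Q u ≡ true → f u ≡ g u) → sumOver P f ≡ sumOver Q g
sumOver-cong {P = P} {Q} {f} {g} P≗Q f≗g = sum-cong-≗ pointwise
  where
    pointwise : ∀ u → (if P u then f u else 0) ≡ (if Q u then g u else 0)
    pointwise u rewrite P≗Q u with Q u in Qu
    ... | true  = f≗g u Qu
    ... | false = refl

∑-if : ∀ {n} (P : Fin n → Bool) (f g : Fin n → ℕ) →
  ∑[ u < n ] (if P u then f u else g u) ≡ sumOver P f + sumOver (not ∘ P) g
∑-if {n} P f g = trans (sum-cong-≗ split) (∑-distrib-+ {n} _ _)
  where
    split : ∀ u → (if P u then f u else g u) ≡ (if P u then f u else 0) + (if not (P u) then g u else 0)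
    split u with P u
    ... | true  = sym (+-identityʳ _)
    ... | false = refl

count≡size : ∀ {n} (P : Fin n → Bool) → count P ≡ size P
count≡size {n} P = sum-allFin n _

count-∧ : ∀ {n} (P Q : Fin n → Bool) → count (λ u → P u ∧ Q u) ≡ sumOver P (indicator ∘ Q)
count-∧ {n} P Q = trans (sum-allFin n _) (sum-cong-≗ pointwise)
  where
    pointwise : ∀ u → indicator (P u ∧ Q u) ≡ (if P u then indicator (Q u) else 0)
    pointwise u with P u
    ... | true  = refl
    ... | false = refl

size-true : ∀ n → size {n} (λ _ → true) ≡ n
size-true n = trans (∑-const n 1) (*-identityˡ n)

indicator-mono : ∀ {a b} → (a ≡ true → b ≡ true) → indicator a ≤ indicator b
indicator-mono {false} _   = z≤n
indicator-mono {true}  a⇒b rewrite a⇒b refl = ≤-refl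

size-mono-≤ : ∀ {n} {P Q : Fin n → Bool} → (∀ u → P u ≡ true → Q u ≡ true) → size P ≤ size Q
size-mono-≤ {zero}  _   = z≤n
size-mono-≤ {suc n} P⇒Q = +-mono-≤ (indicator-mono (P⇒Q 0F)) (size-mono-≤ (P⇒Q ∘ Fin.suc))

size-mono-< : ∀ {n} {P Q : Fin n → Bool} → (∀ u → P u ≡ true → Q u ≡ true) →
  ∀ w → P w ≡ false → Q w ≡ true → size P < size Q
size-mono-< {suc n} P⇒Q 0F Pw Qw rewrite Pw | Qw = s≤s (size-mono-≤ (P⇒Q ∘ Fin.suc))
size-mono-< {suc n} P⇒Q (Fin.suc w) Pw Qw =
  +-mono-≤-< (indicator-mono (P⇒Q 0F)) (size-mono-< (P⇒Q ∘ Fin.suc) w Pw Qw)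

index : ∀ {n} → (Fin n → Bool) → Fin n → ℕ
index P 0F          = 0
index P (Fin.suc u) = indicator (P 0F) + index (P ∘ Fin.suc) u

sumOver-index : ∀ {n} (P : Fin n → Bool) (φ : ℕ → ℕ) →
  sumOver P (φ ∘ index P) ≡ ∑[ j < size P ] φ (toℕ j)
sumOver-index {zero}  P φ = refl
sumOver-index {suc n} P φ
  rewrite sumOver-index (P ∘ Fin.suc) (λ j → φ (indicator (P 0F) + j))
  with P 0F
... | true  = refl
... | false = refl

injective⇒surjective : ∀ {n} {f : Fin n → Fin n} → Injective _≡_ _≡_ f → ∀ k → ∃ λ i → f i ≡ k
injective⇒surjective {suc n} {f} f-inj k with any? (λ i → f i ≟ᶠ k)
... | yes hit  = hit
... | no  miss = ⊥-elim (<⇒notInjective (n<1+n n) punched-injective)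
  where
    punched : Fin (suc n) → Fin n
    punched i = punchOut {i = k} (λ k≡fi → miss (i , sym k≡fi))

    punched-injective : Injective _≡_ _≡_ punched
    punched-injective {i} {j} eq =
      f-inj (punchOut-injective (λ k≡fi → miss (i , sym k≡fi)) (λ k≡fj → miss (j , sym k≡fj)) eq)

injective⇒permutation : ∀ {n} {f : Fin n → Fin n} → Injective _≡_ _≡_ f →
  ∃ λ (π : Permutation′ n) → ∀ i → π ⟨$⟩ʳ i ≡ f i
injective⇒permutation {n} {f} f-inj =
  permutation f (proj₁ ∘ surj) (proj₂ ∘ surj) (λ i → f-inj (proj₂ (surj (f i)))) , λ _ → refl
  where
    surj : ∀ k → ∃ λ i → f i ≡ k
    surj = injective⇒surjective f-inj

orderingBy : ∀ {N} (key : Fin N → ℕ) → Injective _≡_ _≡_ key →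
  ∃ λ (σ : Ordering N) → ∀ u v → (u <[ σ ] v) ≡ (key u <ᵇ key v)
orderingBy {N} key key-inj = σ , σ-orders
  where
    below : Fin N → Fin N → Bool
    below v u = key u <ᵇ key v

    rank : Fin N → ℕ
    rank v = size (below v)

    rank<N : ∀ v → rank v < N
    rank<N v = subst (rank v <_) (size-true N)
      (size-mono-< {P = below v} {Q = λ _ → true} (λ _ _ → refl) v (≥⇒<ᵇ≡false {key v} ≤-refl) refl)

    rank-mono-≤ : ∀ {u v} → key u ≤ key v → rank u ≤ rank v
    rank-mono-≤ {u} {v} ku≤kv = size-mono-≤ {P = below u} {Q = below v}
      (λ w kw<ku → <⇒<ᵇ≡true (<-≤-trans (<ᵇ≡true⇒< kw<ku) ku≤kv))

    rank-mono-< : ∀ {u v} → key u < key v → rank u < rank v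
    rank-mono-< {u} {v} ku<kv = size-mono-< {P = below u} {Q = below v}
      (λ w kw<ku → <⇒<ᵇ≡true (<-trans (<ᵇ≡true⇒< kw<ku) ku<kv))
      u (≥⇒<ᵇ≡false {key u} ≤-refl) (<⇒<ᵇ≡true ku<kv)

    rank-<ᵇ : ∀ u v → (rank u <ᵇ rank v) ≡ (key u <ᵇ key v)
    rank-<ᵇ u v with key u <? key v
    ... | yes ku<kv = trans (<⇒<ᵇ≡true (rank-mono-< ku<kv)) (sym (<⇒<ᵇ≡true ku<kv))
    ... | no  ku≮kv =
      trans (≥⇒<ᵇ≡false (rank-mono-≤ (≮⇒≥ ku≮kv))) (sym (≥⇒<ᵇ≡false (≮⇒≥ ku≮kv)))

    rank-injective : ∀ {u v} → rank u ≡ rank v → u ≡ v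
    rank-injective eq = key-inj (≤-antisym
      (≮⇒≥ λ kv<ku → <⇒≢ (rank-mono-< kv<ku) (sym eq))
      (≮⇒≥ λ ku<kv → <⇒≢ (rank-mono-< ku<kv) eq))

    place : Fin N → Fin N
    place v = fromℕ< (rank<N v)

    toℕ-place : ∀ v → toℕ (place v) ≡ rank v
    toℕ-place v = toℕ-fromℕ< (rank<N v)

    place-injective : Injective _≡_ _≡_ place
    place-injective {u} {v} eq =
      rank-injective (trans (sym (toℕ-place u)) (trans (cong toℕ eq) (toℕ-place v)))

    σ : Ordering N
    σ = proj₁ (injective⇒permutation place-injective)

    σ-place : ∀ v → σ ⟨$⟩ʳ v ≡ place v
    σ-place = proj₂ (injective⇒permutation place-injective)

    σ-orders : ∀ u v → (u <[ σ ] v) ≡ (key u <ᵇ key v)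
    σ-orders u v = begin
      toℕ (σ ⟨$⟩ʳ u) <ᵇ toℕ (σ ⟨$⟩ʳ v)
        ≡⟨ cong₂ (λ i j → toℕ i <ᵇ toℕ j) (σ-place u) (σ-place v) ⟩
      toℕ (place u) <ᵇ toℕ (place v)
        ≡⟨ cong₂ _<ᵇ_ (toℕ-place u) (toℕ-place v) ⟩
      rank u <ᵇ rank v
        ≡⟨ rank-<ᵇ u v ⟩
      key u <ᵇ key v ∎
      where open ≡-Reasoning

data Block : Set where
  left middle right : Block

blockSum : (Block → ℕ) → ℕ → ℕ → ℕ
blockSum h half parity = h left * half + h right * half + h middle * parity

module Halving {n} (P : Fin n → Bool) where
  half parity : ℕ
  half   = size P / 2
  parity = size P % 2

  size≡ : size P ≡ half + (half + parity)
  size≡ = trans (m≡m%n+[m/n]*n (size P) 2)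
    (solve 2 (λ h r → r :+ h :* con 2 := h :+ (h :+ r)) refl half parity)
    where open +-*-Solver

  blockOf : ℕ → Block
  blockOf j = if j <ᵇ half then left else if j <ᵇ half + half then right else middle

  block : Fin n → Block
  block u = blockOf (index P u)

  sumOver-block : ∀ (h : Block → ℕ) → sumOver P (h ∘ block) ≡ blockSum h half parity
  sumOver-block h = begin
      sumOver P (h ∘ block)
    ≡⟨ sumOver-index P (h ∘ blockOf) ⟩
      ∑[ j < size P ] h (blockOf (toℕ j))
    ≡⟨ cong (λ m → ∑[ j < m ] h (blockOf (toℕ j))) size≡ ⟩
      ∑[ j < half + (half + parity) ] h (blockOf (toℕ j))
    ≡⟨ ∑-range-+ half (half + parity) (h ∘ blockOf) ⟩
      ∑[ j < half ] h (blockOf (toℕ j)) + ∑[ j < half + parity ] h (blockOf (half + toℕ j))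
    ≡⟨ cong₂ _+_ (constant-on blockOf on-left) (∑-range-+ half parity (h ∘ blockOf ∘ (half +_))) ⟩
      h left * half
        + (∑[ j < half ] h (blockOf (half + toℕ j)) + ∑[ j < parity ] h (blockOf (half + (half + toℕ j))))
    ≡⟨ cong (h left * half +_) (cong₂ _+_ (constant-on (blockOf ∘ (half +_)) on-right)
                                          (constant-on (blockOf ∘ (half +_) ∘ (half +_)) on-middle)) ⟩
      h left * half + (h right * half + h middle * parity)
    ≡⟨ sym (+-assoc (h left * half) _ _) ⟩
      blockSum h half parity ∎
    where
      open ≡-Reasoning

      constant-on : ∀ {k c} (φ : ℕ → Block) → (∀ j → j < k → φ j ≡ c) →
        ∑[ j < k ] h (φ (toℕ j)) ≡ h c * k
      constant-on {k} {c} φ φ≡c =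
        trans (sum-cong-≗ (λ j → cong h (φ≡c (toℕ j) (toℕ<n j)))) (∑-const k (h c))

      on-left : ∀ j → j < half → blockOf j ≡ left
      on-left j j<half rewrite <⇒<ᵇ≡true j<half = refl

      on-right : ∀ j → j < half → blockOf (half + j) ≡ right
      on-right j j<half
        rewrite ≥⇒<ᵇ≡false {half + j} (m≤m+n half j)
              | <⇒<ᵇ≡true (+-monoʳ-< half j<half) = refl

      on-middle : ∀ j → j < parity → blockOf (half + (half + j)) ≡ middle
      on-middle j _
        rewrite ≥⇒<ᵇ≡false {half + (half + j)} (m≤m+n half (half + j))
              | ≥⇒<ᵇ≡false {half + (half + j)} (+-monoʳ-≤ half (m≤m+n half j)) = refl

slotX slotY : Block → Fin 6
slotX left   = 0F
slotX middle = 2F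
slotX right  = 5F
slotY left   = 1F
slotY middle = 3F
slotY right  = 4F

slotX≢slotY : ∀ c d → slotX c ≢ slotY d
slotX≢slotY left   left   ()
slotX≢slotY left   middle ()
slotX≢slotY left   right  ()
slotX≢slotY middle left   ()
slotX≢slotY middle middle ()
slotX≢slotY middle right  ()
slotX≢slotY right  left   ()
slotX≢slotY right  middle ()
slotX≢slotY right  right  ()

imbalanceAgainst : (Block → Fin 6) → Fin 6 → ℕ → ℕ → ℕ
imbalanceAgainst slot k half parity =
  ∣ blockSum (λ d → indicator (toℕ (slot d) <ᵇ toℕ k)) half parity
  - blockSum (λ d → indicator (toℕ k <ᵇ toℕ (slot d))) half parity ∣

imbalanceX : Block → ℕ → ℕ → ℕ
imbalanceX left   q s = q + q + s
imbalanceX middle q s = s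
imbalanceX right  q s = q + q + s

imbalanceAgainst-slotY : ∀ c q s → imbalanceAgainst slotY (slotX c) q s ≡ imbalanceX c q s
imbalanceAgainst-slotY left   q s rewrite *-identityˡ q | *-identityˡ s =
  ∣-∣-identityˡ (q + q + s)
imbalanceAgainst-slotY middle q s
  rewrite *-identityˡ q | *-identityˡ s | +-identityʳ q | +-identityʳ q = ∣m-m+n∣≡n q s
imbalanceAgainst-slotY right  q s rewrite *-identityˡ q | *-identityˡ s =
  ∣-∣-identityʳ (q + q + s)

imbalanceAgainst-slotX : ∀ c p r → imbalanceAgainst slotX (slotY c) p r ≡ r
imbalanceAgainst-slotX left   p r
  rewrite *-identityˡ p | *-identityˡ r | +-identityʳ p | +-identityʳ p = ∣m-m+n∣≡n p r
imbalanceAgainst-slotX middle p r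
  rewrite *-identityˡ p | *-identityˡ r | +-identityʳ p | ∣-∣-comm (p + r) p = ∣m-m+n∣≡n p r
imbalanceAgainst-slotX right  p r
  rewrite *-identityˡ p | *-identityˡ r | +-identityʳ p | ∣-∣-comm (p + r) p = ∣m-m+n∣≡n p r

module CompleteBipartite {N} (G : Graph N) (part : Fin N → Bool)
                         (complete : IsCompleteBipartite G part) where
  -- opposite b is the part not containing the vertices with part ≡ b, so X is opposite false.
  opposite : Bool → Fin N → Bool
  opposite b u = b xor part u

  module X = Halving (opposite false)
  module Y = Halving (opposite true)

  slot : Fin N → Fin 6
  slot u = if part u then slotX (X.block u) else slotY (Y.block u)

  slot-apart : ∀ u v → opposite (part v) u ≡ true → slot u ≢ slot v
  slot-apart u v h with part u | part v
  slot-apart u v () | true  | true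
  slot-apart u v _  | true  | false = slotX≢slotY _ _
  slot-apart u v _  | false | true  = ≢-sym (slotX≢slotY _ _)
  slot-apart u v () | false | false

  slot-X : ∀ u → opposite false u ≡ true → slot u ≡ slotX (X.block u)
  slot-X u pu rewrite pu = refl

  slot-Y : ∀ u → opposite true u ≡ true → slot u ≡ slotY (Y.block u)
  slot-Y u h with part u
  slot-Y u () | true
  slot-Y u _  | false = refl

  key : Fin N → ℕ
  key v = toℕ (combine (slot v) v)

  key-injective : Injective _≡_ _≡_ key
  key-injective {u} {v} eq = combine-injectiveʳ (slot u) u (slot v) v (toℕ-injective eq)

  σ : Ordering N
  σ = proj₁ (orderingBy key key-injective)

  precedes : ∀ {u v} → slot u ≢ slot v → (u <[ σ ] v) ≡ (toℕ (slot u) <ᵇ toℕ (slot v))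
  precedes {u} {v} apart = trans (proj₂ (orderingBy key key-injective) u v) (combine-<ᵇ u v apart)

  before≡ : ∀ v → count (λ u → adj G v u ∧ (u <[ σ ] v))
                ≡ sumOver (opposite (part v)) (λ u → indicator (toℕ (slot u) <ᵇ toℕ (slot v)))
  before≡ v = trans (count-∧ (adj G v) _)
    (sumOver-cong (complete v) (λ u h → cong indicator (precedes (slot-apart u v h))))

  after≡ : ∀ v → count (λ u → adj G v u ∧ (v <[ σ ] u))
               ≡ sumOver (opposite (part v)) (λ u → indicator (toℕ (slot v) <ᵇ toℕ (slot u)))
  after≡ v = trans (count-∧ (adj G v) _)
    (sumOver-cong (complete v) (λ u h → cong indicator (precedes (≢-sym (slot-apart u v h)))))

  module _ (b : Bool) (oppositeSlot : Block → Fin 6)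
           (slot-opposite : ∀ u → opposite b u ≡ true →
                            slot u ≡ oppositeSlot (Halving.block (opposite b) u)) where
    open Halving (opposite b)

    vertexImbalance-by-blocks : ∀ v → part v ≡ b →
      vertexImbalance G σ v ≡ imbalanceAgainst oppositeSlot (slot v) half parity
    vertexImbalance-by-blocks v pv = cong₂ ∣_-_∣
      (trans (before≡ v) (by-blocks (λ k → indicator (toℕ k <ᵇ toℕ (slot v)))))
      (trans (after≡ v)  (by-blocks (λ k → indicator (toℕ (slot v) <ᵇ toℕ k))))
      where
        by-blocks : ∀ (φ : Fin 6 → ℕ) →
          sumOver (opposite (part v)) (φ ∘ slot) ≡ blockSum (φ ∘ oppositeSlot) half parity
        by-blocks φ = trans
          (sumOver-cong (λ u → cong (_xor part u) pv) (λ u h → cong φ (slot-opposite u h)))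
          (sumOver-block (φ ∘ oppositeSlot))

  vertexImbalance-X : ∀ v → part v ≡ true →
    vertexImbalance G σ v ≡ imbalanceX (X.block v) Y.half Y.parity
  vertexImbalance-X v pv = begin
      vertexImbalance G σ v
    ≡⟨ vertexImbalance-by-blocks true slotY slot-Y v pv ⟩
      imbalanceAgainst slotY (slot v) Y.half Y.parity
    ≡⟨ cong (λ k → imbalanceAgainst slotY k Y.half Y.parity) (slot-X v pv) ⟩
      imbalanceAgainst slotY (slotX (X.block v)) Y.half Y.parity
    ≡⟨ imbalanceAgainst-slotY (X.block v) Y.half Y.parity ⟩
      imbalanceX (X.block v) Y.half Y.parity ∎
    where open ≡-Reasoning

  vertexImbalance-Y : ∀ v → part v ≡ false → vertexImbalance G σ v ≡ X.parity
  vertexImbalance-Y v pv = begin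
      vertexImbalance G σ v
    ≡⟨ vertexImbalance-by-blocks false slotX slot-X v pv ⟩
      imbalanceAgainst slotX (slot v) X.half X.parity
    ≡⟨ cong (λ k → imbalanceAgainst slotX k X.half X.parity) (slot-Y v (cong not pv)) ⟩
      imbalanceAgainst slotX (slotY (Y.block v)) X.half X.parity
    ≡⟨ imbalanceAgainst-slotX (Y.block v) X.half X.parity ⟩
      X.parity ∎
    where open ≡-Reasoning

  vertexImbalance-by-part : ∀ v →
    vertexImbalance G σ v ≡ (if part v then imbalanceX (X.block v) Y.half Y.parity else X.parity)
  vertexImbalance-by-part v = on-part (part v) refl
    where
      on-part : ∀ b → part v ≡ b →
        vertexImbalance G σ v ≡ (if b then imbalanceX (X.block v) Y.half Y.parity else X.parity)
      on-part true  = vertexImbalance-X v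
      on-part false = vertexImbalance-Y v

  imbalance≡ : imbalance G σ
             ≡ count part * count (not ∘ part) + (count part % 2) * (count (not ∘ part) % 2)
  imbalance≡ = begin
      imbalance G σ
    ≡⟨ trans (sum-allFin N _) (sum-cong-≗ vertexImbalance-by-part) ⟩
      ∑[ v < N ] (if part v then imbalanceX (X.block v) Y.half Y.parity else X.parity)
    ≡⟨ ∑-if part _ _ ⟩
      sumOver part (λ v → imbalanceX (X.block v) Y.half Y.parity)
        + sumOver (not ∘ part) (λ _ → X.parity)
    ≡⟨ cong₂ _+_ (X.sumOver-block (λ c → imbalanceX c Y.half Y.parity))
                 (Y.sumOver-block (λ _ → X.parity)) ⟩
      blockSum (λ c → imbalanceX c Y.half Y.parity) X.half X.parity
        + blockSum (λ _ → X.parity) Y.half Y.parity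
    ≡⟨ total X.half X.parity Y.half Y.parity ⟩
      (X.half + (X.half + X.parity)) * (Y.half + (Y.half + Y.parity)) + X.parity * Y.parity
    ≡⟨ cong₂ (λ x y → x * y + X.parity * Y.parity) (sym X.size≡) (sym Y.size≡) ⟩
      size part * size (not ∘ part) + (size part % 2) * (size (not ∘ part) % 2)
    ≡⟨ cong₂ (λ x y → x * y + (x % 2) * (y % 2)) (count≡size part) (count≡size (not ∘ part)) ⟨
      count part * count (not ∘ part) + (count part % 2) * (count (not ∘ part) % 2) ∎
    where
      open ≡-Reasoning
      total : ∀ p r q s → (q + q + s) * p + (q + q + s) * p + s * r + (r * q + r * q + r * s)
                        ≡ (p + (p + r)) * (q + (q + s)) + r * s
      total = solve 4 (λ p r q s →
          (q :+ q :+ s) :* p :+ (q :+ q :+ s) :* p :+ s :* r :+ (r :* q :+ r :* q :+ r :* s)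
        := (p :+ (p :+ r)) :* (q :+ (q :+ s)) :+ r :* s) refl
        where open +-*-Solver

lemma1 : ∀ {N : ℕ} (G : Graph N) (part : Fin N → Bool) → Connected G → IsCompleteBipartite G part →
    ∃ λ (σ : Ordering N) → imbalance G σ ≡ count part * count (λ v → not (part v)) + (count part % 2) * (count (λ v → not (part v)) % 2)
lemma1 G part _ complete = σ , imbalance≡
  where open CompleteBipartite G part complete
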